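{- Let $m, n$ be positive integers with $m \le n$, let $u, v \in \Sigma^\star$, and let $r \in R_{m,n}(u) \cap R_{m,n}(v)$. Then Samson has a winning strategy in the game $\mathrm{FO}^2_{m,n}(u,v)$ starting from a configuration (with arbitrary $y$-pebble positions) in which $\mathrm{ord}(r(u), x^u) \ne \mathrm{ord}(r(v), x^v)$. Furthermore, Samson has such a winning strategy whose first move is on $u$ if either ($r$ ends with $\triangleright$, $r(u)\le x^u$ and $r(v)\ge x^v$) or ($r$ ends with $\triangleleft$, $r(u)\ge x^u$ and $r(v)\le x^v$); and he has such a winning strategy whose first move is on $v$ if either ($r$ ends with $\triangleright$, $r(u)\ge x^u$ and $r(v)\le x^v$) or ($r$ ends with $\triangleleft$, $r(u)\le x^u$ and $r(v)\ge x^v$).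
   Context: $\Sigma$ is a finite alphabet. A boundary position is a symbol $d_{\mathtt a}$ with direction $d\in\{\triangleright,\triangleleft\}$ and $\mathtt a\in\Sigma$; on a word $w=w_1\cdots w_{|w|}$: $\triangleright_{\mathtt a}(w)=\min\{i\in[1,|w|]: w_i=\mathtt a\}$, $\triangleleft_{\mathtt a}(w)=\max\{i\in[1,|w|]: w_i=\mathtt a\}$, and relative to a position $q$: $\triangleright_{\mathtt a}(w,q)=\min\{i\in[q+1,|w|]: w_i=\mathtt a\}$, $\triangleleft_{\mathtt a}(w,q)=\max\{i\in[1,q-1]: w_i=\mathtt a\}$ (min/max of the empty set undefined). An $n$-ranker $r=(p_1,\dots,p_n)$ is a sequence of $n$ boundary positions with $r(w)=p_1(w)$ if $n=1$, $r(w)$ undefined if $(p_1,\dots,p_{n-1})(w)$ is undefined, and otherwise $r(w)=p_n(w,(p_1,\dots,p_{n-1})(w))$. An $(m,n)$-ranker ($m$-alternation $n$-ranker) is an $n$-ranker whose sequence of directions consists of exactly $m$ maximal blocks of equal direction; it "ends with $d$" if $p_n$ has direction $d$. $R_{m,n}(w)$ is the set of $(m,n)$-rankers defined on $w$. $\mathrm{ord}(i,j)\in\{<,=,>\}$ is the order type of $i,j$. The game $\mathrm{FO}^2_{m,n}(u,v)$: two pebble pairs $x,y$, with pebbles $x^u,y^u$ on $u$ and $x^v,y^v$ on $v$; it lasts $n$ moves; in each move Samson picks a pair $x$ or $y$ and places its pebble on a position of one of the two words, Delilah then places the mate on a position of the other word; Samson may change the word on which he plays at most $m-1$ times. Samson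 wins if, initially or after some move, the map $x^u\mapsto x^v$, $y^u\mapsto y^v$ is not an isomorphism of induced substructures (letters, equality and order of pebbled positions); otherwise Delilah wins. -}

module Defs where

open import Data.Nat using (ℕ; zero; suc; _<?_; _≤_)
open import Data.Fin using (Fin; toℕ)
open import Data.Fin.Properties using () renaming (_≟_ to _≟F_)
open import Data.List using (List; []; _∷_; length; lookup; filter; head; last; map)
open import Data.Maybe using (Maybe; just; nothing)
open import Data.Product using (Σ; _×_; _,_; proj₁)
open import Data.Sum using (_⊎_)
open import Relation.Nullary using (¬_; yes; no)
open import Relation.Binary.PropositionalEquality using (_≡_; _≢_)

Word : ℕ → Set
Word k = List (Fin k)

data Ord : Set where
  lt eq gt : Ord

ord : ℕ → ℕ → Ord
ord zero    zero    = eq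
ord zero    (suc _) = lt
ord (suc _) zero    = gt
ord (suc i) (suc j) = ord i j

-- Boundary positions and rankers (positions are 1-based, as in the paper)

data Dir : Set where
  ▷ ◁ : Dir

BPos : ℕ → Set
BPos k = Dir × Fin k

occ : ∀ {k} → Fin k → Word k → ℕ → List ℕ
occ a []      i = []
occ a (b ∷ w) i with a ≟F b
... | yes _ = i ∷ occ a w (suc i)
... | no  _ = occ a w (suc i)

positions : ∀ {k} → Fin k → Word k → List ℕ
positions a w = occ a w 1

firstAfter : ∀ {k} → Fin k → Word k → ℕ → Maybe ℕ
firstAfter a w q = head (filter (q <?_) (positions a w))

lastBefore : ∀ {k} → Fin k → Word k → ℕ → Maybe ℕ
lastBefore a w q = last (filter (_<? q) (positions a w))

bposAbs : ∀ {k} → BPos k → Word k → Maybe ℕ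
bposAbs (▷ , a) w = head (positions a w)
bposAbs (◁ , a) w = last (positions a w)

bposRel : ∀ {k} → BPos k → Word k → ℕ → Maybe ℕ
bposRel (▷ , a) w q = firstAfter a w q
bposRel (◁ , a) w q = lastBefore a w q

Ranker : ℕ → Set
Ranker k = List (BPos k)

evalFrom : ∀ {k} → Word k → List (BPos k) → Maybe ℕ → Maybe ℕ
evalFrom w []       mq       = mq
evalFrom w (p ∷ ps) nothing  = nothing
evalFrom w (p ∷ ps) (just q) = evalFrom w ps (bposRel p w q)

eval : ∀ {k} → Word k → Ranker k → Maybe ℕ
eval w []       = nothing
eval w (p ∷ ps) = evalFrom w ps (bposAbs p w)

sameDir : Dir → Dir → ℕ
sameDir ▷ ▷ = 0
sameDir ◁ ◁ = 0
sameDir _ _ = 1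

blocks : List Dir → ℕ
blocks []           = 0
blocks (d ∷ [])     = 1
blocks (d ∷ e ∷ ds) = sameDir d e Data.Nat.+ blocks (e ∷ ds)

IsRanker : ∀ {k} → ℕ → ℕ → Ranker k → Set
IsRanker m n r = length r ≡ n × blocks (map proj₁ r) ≡ m

EndsWith : ∀ {k} → Dir → Ranker k → Set
EndsWith d r = last (map proj₁ r) ≡ just d

-- 1-based value of a (0-based) Fin position
pos1 : ∀ {n} → Fin n → ℕ
pos1 i = suc (toℕ i)

record Config (lu lv : ℕ) : Set where
  constructor conf
  field
    xu yu : Fin lu
    xv yv : Fin lv
open Config public

-- the map x^u ↦ x^v, y^u ↦ y^v is an isomorphism of induced substructures
Iso : ∀ {k} (u v : Word k) → Config (length u) (length v) → Set
Iso u v c =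
  lookup u (xu c) ≡ lookup v (xv c) ×
  lookup u (yu c) ≡ lookup v (yv c) ×
  ord (toℕ (xu c)) (toℕ (yu c)) ≡ ord (toℕ (xv c)) (toℕ (yv c))

data Peb : Set where
  X Y : Peb

data Side : Set where
  U V : Side

place : ∀ {lu lv} → Peb → Fin lu → Fin lv → Config lu lv → Config lu lv
place X i j (conf _ yu _ yv) = conf i yu j yv
place Y i j (conf xu _ xv _) = conf xu i xv j

-- Step last s b b' : Samson, having last played on 'last' (nothing = no move yet)
-- with b remaining allowed word changes, may play on s, leaving b' changes.
data Step : Maybe Side → Side → ℕ → ℕ → Set where
  first  : ∀ {s b} → Step nothing s b b
  stay   : ∀ {s b} → Step (just s) s b b
  change : ∀ {s t b} → s ≢ t → Step (just t) s (suc b) b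

mutual
  -- Samson has a winning strategy with k moves remaining, b word changes left,
  -- last move made on 'l', from configuration c.
  Wins : ∀ {k} (u v : Word k) → ℕ → ℕ → Maybe Side → Config (length u) (length v) → Set
  Wins u v zero    b l c = ¬ Iso u v c
  Wins u v (suc n) b l c = ¬ Iso u v c ⊎ Σ Side (λ s → MoveWins u v n b l s c)

  MoveWins : ∀ {k} (u v : Word k) → ℕ → ℕ → Maybe Side → Side → Config (length u) (length v) → Set
  MoveWins u v n b l U c =
    Σ ℕ λ b' → Step l U b b' × Σ Peb λ p → Σ (Fin (length u)) λ i →
      (j : Fin (length v)) → Wins u v n b' (just U) (place p i j c)
  MoveWins u v n b l V c =
    Σ ℕ λ b' → Step l V b b' × Σ Peb λ p → Σ (Fin (length v)) λ j →
      (i : Fin (length u)) → Wins u v n b' (just V) (place p i j c)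

WinsStartingOn : ∀ {k} (u v : Word k) → ℕ → ℕ → Side → Config (length u) (length v) → Set
WinsStartingOn u v zero    b s c = ¬ Iso u v c
WinsStartingOn u v (suc n) b s c = ¬ Iso u v c ⊎ MoveWins u v n b nothing s c

module Submission where

-- Write r = r' · (d , a).  Say d = ▷ and r(u) ≤ x^u, x^v ≤ r(v).  Samson puts
-- the y-pebble on r(u) in u.  Delilah must answer with an a-position j of v.  If j is
-- after r'(v), then j ≥ r(v) (r(v) is the first a after r'(v)), and the order of j
-- relative to x^v cannot copy that of r(u) relative to x^u.  So j ≤ r'(v), whereas
-- r(u) > r'(u): the new pebbles are separated by the shorter ranker r', and the
-- roles of x and y are exchanged.  Samson continues by induction on the same word if
-- r' ends with the same direction as r (same number of blocks), and on the other word
-- otherwise (one block fewer, one word change used).  The case ◁ is the mirror image.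

open import Defs
open import Data.Nat using (ℕ; zero; suc; _+_; _∸_; _≤_; _<_; _<?_; z≤n; s≤s)
open import Data.Nat.Properties
  using (≤-refl; ≤-reflexive; ≤-trans; ≤-antisym; <⇒≤; <⇒≱; ≤-<-connex; m≤n⇒m<n∨m≡n;
         +-identityʳ; +-suc; +-comm; suc-injective; +-commutativeSemigroup)
open import Algebra.Properties.CommutativeSemigroup +-commutativeSemigroup using (x∙yz≈y∙xz)
open import Data.Fin using (Fin; toℕ) renaming (zero to fzero; suc to fsuc)
open import Data.Fin.Properties using () renaming (_≟_ to _≟F_)
open import Data.List using (List; []; _∷_; [_]; _∷ʳ_; length; lookup; filter; head; last; map;
                             initLast; _∷ʳ′_)
open import Data.List.Properties using (map-++; length-++)
open import Data.List.Membership.Propositional using (_∈_)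
open import Data.List.Membership.Propositional.Properties using (∈-filter⁺; ∈-filter⁻)
open import Data.List.Relation.Unary.Any using (here; there)
open import Data.List.Relation.Unary.All as All using (All; []; _∷_)
open import Data.List.Relation.Unary.AllPairs using (AllPairs; []; _∷_)
import Data.List.Relation.Unary.AllPairs.Properties as AllPairs
open import Data.Maybe using (Maybe; just; nothing; _>>=_)
import Data.Maybe as Maybe
open import Data.Maybe.Properties using (just-injective)
open import Data.Product using (Σ; _×_; _,_; proj₁; uncurry)
open import Data.Sum using (_⊎_; inj₁; inj₂)
import Data.Sum as Sum
open import Data.Empty using (⊥-elim)
open import Function using (_∘_)
open import Relation.Nullary using (¬_; Dec; yes; no)
open import Relation.Binary.PropositionalEquality using (_≡_; _≢_; refl; sym; trans; cong; subst)

flipOrd : Ord → Ord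
flipOrd lt = gt
flipOrd eq = eq
flipOrd gt = lt

ord-flip : ∀ a b → ord b a ≡ flipOrd (ord a b)
ord-flip zero    zero    = refl
ord-flip zero    (suc b) = refl
ord-flip (suc a) zero    = refl
ord-flip (suc a) (suc b) = ord-flip a b

ord-flip-≡ : ∀ a b c e → ord a b ≡ ord c e → ord b a ≡ ord e c
ord-flip-≡ a b c e same =
  trans (ord-flip a b) (trans (cong flipOrd same) (sym (ord-flip c e)))

ord-refl : ∀ a → ord a a ≡ eq
ord-refl zero    = refl
ord-refl (suc a) = ord-refl a

ord-≡ : ∀ {a b} → a ≡ b → ord a b ≡ eq
ord-≡ {a} refl = ord-refl a

lt-ord : ∀ {a b} → a < b → ord a b ≡ lt
lt-ord {zero}  {suc b} _       = refl
lt-ord {suc a} {suc b} (s≤s h) = lt-ord h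

gt-ord : ∀ {a b} → b < a → ord a b ≡ gt
gt-ord {suc a} {zero}  _       = refl
gt-ord {suc a} {suc b} (s≤s h) = gt-ord h

ord-lt : ∀ {a b} → ord a b ≡ lt → a < b
ord-lt {zero}  {suc b} refl = s≤s z≤n
ord-lt {suc a} {suc b} h    = s≤s (ord-lt h)

ord-gt : ∀ {a b} → ord a b ≡ gt → b < a
ord-gt {suc a} {zero}  refl = s≤s z≤n
ord-gt {suc a} {suc b} h    = s≤s (ord-gt h)

ord-eq : ∀ {a b} → ord a b ≡ eq → a ≡ b
ord-eq {zero}  {zero}  refl = refl
ord-eq {suc a} {suc b} h    = cong suc (ord-eq h)

-- If x lies weakly above p and y weakly below q, then x, p and y, q can only have the
-- same order type by both being equal: the core of every "Delilah cannot copy" step.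
ord-squeeze : ∀ {p x y q} → p ≤ x → y ≤ q → ord x p ≡ ord y q → x ≡ p × y ≡ q
ord-squeeze {p} p≤x y≤q same with m≤n⇒m<n∨m≡n p≤x
... | inj₁ p<x  = ⊥-elim (<⇒≱ (ord-gt (trans (sym same) (gt-ord p<x))) y≤q)
... | inj₂ refl = refl , ord-eq (trans (sym same) (ord-refl p))

separate : ∀ p x q y → ord p x ≢ ord q y → (p ≤ x × y ≤ q) ⊎ (x ≤ p × q ≤ y)
separate p x q y differ with ord p x in e₁ | ord q y in e₂
... | lt | lt = ⊥-elim (differ refl)
... | eq | eq = ⊥-elim (differ refl)
... | gt | gt = ⊥-elim (differ refl)
... | lt | eq = inj₁ (<⇒≤ (ord-lt e₁) , ≤-reflexive (sym (ord-eq e₂)))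
... | lt | gt = inj₁ (<⇒≤ (ord-lt e₁) , <⇒≤ (ord-gt e₂))
... | eq | gt = inj₁ (≤-reflexive (ord-eq e₁) , <⇒≤ (ord-gt e₂))
... | eq | lt = inj₂ (≤-reflexive (sym (ord-eq e₁)) , <⇒≤ (ord-lt e₂))
... | gt | lt = inj₂ (<⇒≤ (ord-gt e₁) , <⇒≤ (ord-lt e₂))
... | gt | eq = inj₂ (<⇒≤ (ord-gt e₁) , ≤-reflexive (ord-eq e₂))

-- The order of ℕ read in direction d: ▷ is the usual order, ◁ the reversed one.
-- It lets the cases ▷ and ◁ of the proof be handled at once.

infix 4 _≤[_]_ _<[_]_ _<[_]?_

_≤[_]_ : ℕ → Dir → ℕ → Set
m ≤[ ▷ ] n = m ≤ n
m ≤[ ◁ ] n = n ≤ m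

_<[_]_ : ℕ → Dir → ℕ → Set
m <[ ▷ ] n = m < n
m <[ ◁ ] n = n < m

_<[_]?_ : ∀ m d n → Dec (m <[ d ] n)
m <[ ▷ ]? n = m <? n
m <[ ◁ ]? n = n <? m

≤[]-trans : ∀ d {m n o} → m ≤[ d ] n → n ≤[ d ] o → m ≤[ d ] o
≤[]-trans ▷ m≤n n≤o = ≤-trans m≤n n≤o
≤[]-trans ◁ m≤n n≤o = ≤-trans n≤o m≤n

≤[]-antisym : ∀ d {m n} → m ≤[ d ] n → n ≤[ d ] m → m ≡ n
≤[]-antisym ▷ m≤n n≤m = ≤-antisym m≤n n≤m
≤[]-antisym ◁ m≤n n≤m = ≤-antisym n≤m m≤n

<[]⇒≤[] : ∀ d {m n} → m <[ d ] n → m ≤[ d ] n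
<[]⇒≤[] ▷ = <⇒≤
<[]⇒≤[] ◁ = <⇒≤

≤[]-<[]-connex : ∀ d m n → m ≤[ d ] n ⊎ n <[ d ] m
≤[]-<[]-connex ▷ m n = ≤-<-connex m n
≤[]-<[]-connex ◁ m n = ≤-<-connex n m

ord-squeeze[] : ∀ d {p x y q} → p ≤[ d ] x → y ≤[ d ] q → ord x p ≡ ord y q → x ≡ p × y ≡ q
ord-squeeze[] ▷ p≤x y≤q same = ord-squeeze p≤x y≤q same
ord-squeeze[] ◁ {p} {x} {y} {q} x≤p q≤y same
  with ord-squeeze x≤p q≤y (ord-flip-≡ x p y q same)
... | p≡x , q≡y = sym p≡x , sym q≡y

ord-separated : ∀ d {p x y q} → p <[ d ] x → y ≤[ d ] q → ord p x ≢ ord q y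
ord-separated ▷ p<x y≤q same = <⇒≱ (ord-lt (trans (sym same) (lt-ord p<x))) y≤q
ord-separated ◁ x<p q≤y same = <⇒≱ (ord-gt (trans (sym same) (gt-ord x<p))) q≤y

-- Where the pebbles stand relative to the ranker values pu, pv for Samson to be able
-- to start on u (resp. v), for a ranker ending with direction d.
Start : Side → Dir → ℕ → ℕ → ℕ → ℕ → Set
Start U d pu pv x y = pu ≤[ d ] x × y ≤[ d ] pv
Start V d pu pv x y = x ≤[ d ] pu × pv ≤[ d ] y

start-cases : ∀ d {pu pv x y} → ord pu x ≢ ord pv y → Start U d pu pv x y ⊎ Start V d pu pv x y
start-cases ▷ {pu} {pv} {x} {y} differ = separate pu x pv y differ
start-cases ◁ {pu} {pv} {x} {y} differ = Sum.swap (separate pu x pv y differ)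

OccursFrom : ∀ {k} → Fin k → Word k → ℕ → ℕ → Set
OccursFrom a w i x = Σ (Fin (length w)) λ j → i + toℕ j ≡ x × lookup w j ≡ a

Occurs : ∀ {k} → Fin k → Word k → ℕ → Set
Occurs a w p = OccursFrom a w 1 p

occurs-shift : ∀ {k} {a : Fin k} {w : Word k} {i x} b → OccursFrom a w (suc i) x → OccursFrom a (b ∷ w) i x
occurs-shift {i = i} b (j , pos , letter) = fsuc j , trans (+-suc i (toℕ j)) pos , letter

∈-occ⁻ : ∀ {k} (a : Fin k) (w : Word k) i {x} → x ∈ occ a w i → OccursFrom a w i x
∈-occ⁻ a (b ∷ w) i x∈ with a ≟F b | x∈
... | yes a≡b | here refl = fzero , +-identityʳ i , sym a≡b
... | yes _   | there x∈′ = occurs-shift b (∈-occ⁻ a w (suc i) x∈′)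
... | no _    | x∈′       = occurs-shift b (∈-occ⁻ a w (suc i) x∈′)

∈-occ⁺ : ∀ {k} (a : Fin k) (w : Word k) i (j : Fin (length w)) → lookup w j ≡ a →
         i + toℕ j ∈ occ a w i
∈-occ⁺ a (b ∷ w) i j letter with a ≟F b | j
... | yes _   | fzero  = here (+-identityʳ i)
... | yes _   | fsuc j′ = there (subst (_∈ occ a w (suc i)) (sym (+-suc i (toℕ j′)))
                                       (∈-occ⁺ a w (suc i) j′ letter))
... | no a≢b  | fzero  = ⊥-elim (a≢b (sym letter))
... | no _    | fsuc j′ = subst (_∈ occ a w (suc i)) (sym (+-suc i (toℕ j′)))
                                (∈-occ⁺ a w (suc i) j′ letter)

occ-bounded : ∀ {k} (a : Fin k) (w : Word k) i → All (i ≤_) (occ a w i)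
occ-bounded a []      i = []
occ-bounded a (b ∷ w) i with a ≟F b
... | yes _ = ≤-refl ∷ All.map <⇒≤ (occ-bounded a w (suc i))
... | no  _ = All.map <⇒≤ (occ-bounded a w (suc i))

occ-ascending : ∀ {k} (a : Fin k) (w : Word k) i → AllPairs _<_ (occ a w i)
occ-ascending a []      i = []
occ-ascending a (b ∷ w) i with a ≟F b
... | yes _ = occ-bounded a w (suc i) ∷ occ-ascending a w (suc i)
... | no  _ = occ-ascending a w (suc i)

pick : Dir → List ℕ → Maybe ℕ
pick ▷ = head
pick ◁ = last

pick-extreme : ∀ d {xs p} → AllPairs _<_ xs → pick d xs ≡ just p →
               p ∈ xs × (∀ {y} → y ∈ xs → p ≤[ d ] y)
pick-extreme ▷ {x ∷ xs} (x< ∷ _) refl = here refl , λ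
  { (here refl) → ≤-refl
  ; (there y∈)  → <⇒≤ (All.lookup x< y∈) }
pick-extreme ◁ {x ∷ []}     _         refl = here refl , λ { (here refl) → ≤-refl }
pick-extreme ◁ {x ∷ y ∷ ys} (x< ∷ ys<) picked with pick-extreme ◁ ys< picked
... | p∈ , p-max = there p∈ , λ
  { (here refl) → ≤-trans (<⇒≤ (All.lookup x< (here refl))) (p-max (here refl))
  ; (there z∈)  → p-max z∈ }

bposAbs-pick : ∀ {k} d (a : Fin k) w → bposAbs (d , a) w ≡ pick d (positions a w)
bposAbs-pick ▷ a w = refl
bposAbs-pick ◁ a w = refl

bposRel-pick : ∀ {k} d (a : Fin k) w q → bposRel (d , a) w q ≡ pick d (filter (q <[ d ]?_) (positions a w))
bposRel-pick ▷ a w q = refl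
bposRel-pick ◁ a w q = refl

bposAbs-spec : ∀ {k} d (a : Fin k) (w : Word k) {p} → bposAbs (d , a) w ≡ just p →
               Occurs a w p × (∀ j → lookup w j ≡ a → p ≤[ d ] pos1 j)
bposAbs-spec d a w picked
  with p∈ , p-min ← pick-extreme d (occ-ascending a w 1) (trans (sym (bposAbs-pick d a w)) picked)
  = ∈-occ⁻ a w 1 p∈ , λ j letter → p-min (∈-occ⁺ a w 1 j letter)

bposRel-spec : ∀ {k} d (a : Fin k) (w : Word k) {q p} → bposRel (d , a) w q ≡ just p →
               Occurs a w p × q <[ d ] p × (∀ j → lookup w j ≡ a → q <[ d ] pos1 j → p ≤[ d ] pos1 j)
bposRel-spec d a w {q} picked
  with p∈ , p-min ← pick-extreme d (AllPairs.filter⁺ (q <[ d ]?_) (occ-ascending a w 1))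
                                  (trans (sym (bposRel-pick d a w q)) picked)
  with p∈′ , q<p ← ∈-filter⁻ (q <[ d ]?_) p∈
  = ∈-occ⁻ a w 1 p∈′ , q<p ,
    λ j letter q<j → p-min (∈-filter⁺ (q <[ d ]?_) (∈-occ⁺ a w 1 j letter) q<j)

dirs : ∀ {k} → Ranker k → List Dir
dirs = map proj₁

dirs-∷ʳ : ∀ {k} (r : Ranker k) p → dirs (r ∷ʳ p) ≡ dirs r ∷ʳ proj₁ p
dirs-∷ʳ r p = map-++ proj₁ r [ p ]

length-init : ∀ {A : Set} (xs : List A) x {n} → length (xs ∷ʳ x) ≡ suc n → length xs ≡ n
length-init xs x len = suc-injective (trans (+-comm 1 (length xs)) (trans (sym (length-++ xs)) len))

last-∷ʳ : ∀ {A : Set} (xs : List A) x → last (xs ∷ʳ x) ≡ just x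
last-∷ʳ []           x = refl
last-∷ʳ (y ∷ [])     x = refl
last-∷ʳ (y ∷ z ∷ zs) x = last-∷ʳ (z ∷ zs) x

endsWith-∷ʳ : ∀ {k e} (r : Ranker k) p → EndsWith e (r ∷ʳ p) → e ≡ proj₁ p
endsWith-∷ʳ r p ends =
  just-injective (trans (sym ends) (trans (cong last (dirs-∷ʳ r p)) (last-∷ʳ (dirs r) (proj₁ p))))

evalFrom-∷ʳ : ∀ {k} (w : Word k) ps p mq → evalFrom w (ps ∷ʳ p) mq ≡ (evalFrom w ps mq >>= bposRel p w)
evalFrom-∷ʳ w []       p nothing  = refl
evalFrom-∷ʳ w []       p (just q) = refl
evalFrom-∷ʳ w (_ ∷ ps) p nothing  = refl
evalFrom-∷ʳ w (x ∷ ps) p (just q) = evalFrom-∷ʳ w ps p (bposRel x w q)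

>>=-just : ∀ {A B : Set} (m : Maybe A) {f : A → Maybe B} {z} → (m >>= f) ≡ just z →
           Σ A λ q → m ≡ just q × f q ≡ just z
>>=-just (just q) fq = q , refl , fq

eval-∷ʳ : ∀ {k} (w : Word k) r p′ p {z} → eval w ((r ∷ʳ p′) ∷ʳ p) ≡ just z →
          Σ ℕ λ q → eval w (r ∷ʳ p′) ≡ just q × bposRel p w q ≡ just z
eval-∷ʳ w r p′ p defined = >>=-just (eval w (r ∷ʳ p′)) (trans (sym (unfold r)) defined)
  where
    unfold : ∀ r → eval w ((r ∷ʳ p′) ∷ʳ p) ≡ (eval w (r ∷ʳ p′) >>= bposRel p w)
    unfold []      = evalFrom-∷ʳ w [] p (bposAbs p′ w)
    unfold (x ∷ r) = evalFrom-∷ʳ w (r ∷ʳ p′) p (bposAbs x w)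

blocks-∷ʳ : ∀ ds d′ d → blocks ((ds ∷ʳ d′) ∷ʳ d) ≡ sameDir d′ d + blocks (ds ∷ʳ d′)
blocks-∷ʳ []           d′ d = refl
blocks-∷ʳ (x ∷ [])     d′ d = x∙yz≈y∙xz (sameDir x d′) (sameDir d′ d) 1
blocks-∷ʳ (x ∷ y ∷ ys) d′ d =
  trans (cong (sameDir x y +_) (blocks-∷ʳ (y ∷ ys) d′ d))
        (x∙yz≈y∙xz (sameDir x y) (sameDir d′ d) (blocks ((y ∷ ys) ∷ʳ d′)))

blocks-∷ʳ-positive : ∀ ds d → Σ ℕ λ b → blocks (ds ∷ʳ d) ≡ suc b
blocks-∷ʳ-positive []           d = 0 , refl
blocks-∷ʳ-positive (x ∷ [])     d = sameDir x d , +-comm (sameDir x d) 1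
blocks-∷ʳ-positive (x ∷ y ∷ ys) d with blocks-∷ʳ-positive (y ∷ ys) d
... | b , nonempty = sameDir x y + b , trans (cong (sameDir x y +_) nonempty) (+-suc (sameDir x y) b)

-- The word Samson plays on next, having played on u for a block ending with
-- direction d, when the previous boundary position has direction d′.
turn : Dir → Dir → Side
turn ▷ ▷ = U
turn ◁ ◁ = U
turn ▷ ◁ = V
turn ◁ ▷ = V

turn-step : ∀ d′ d b → Step (just U) (turn d′ d) (sameDir d′ d + b) b
turn-step ▷ ▷ b = stay
turn-step ◁ ◁ b = stay
turn-step ▷ ◁ b = change (λ ())
turn-step ◁ ▷ b = change (λ ())

blocks-turn : ∀ ds d′ d {b} → blocks ((ds ∷ʳ d′) ∷ʳ d) ≡ suc b →
              Σ ℕ λ b′ → Step (just U) (turn d′ d) b b′ × blocks (ds ∷ʳ d′) ≡ suc b′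
blocks-turn ds d′ d {b} total with blocks-∷ʳ-positive ds d′
... | b′ , prefix = b′ , subst (λ c → Step (just U) (turn d′ d) c b′) (sym budget) (turn-step d′ d b′) , prefix
  where
    budget : b ≡ sameDir d′ d + b′
    budget = suc-injective (trans (sym total) (trans (blocks-∷ʳ ds d′ d)
               (trans (cong (sameDir d′ d +_) prefix) (+-suc (sameDir d′ d) b′))))

-- a position pair Samson may start from on u for direction d is one he may start from
-- on `turn d′ d` for direction d′ (reversing d means exchanging the words)
turn-start : ∀ d′ d {qu qv x y} → Start U d qu qv x y → Start (turn d′ d) d′ qu qv x y
turn-start ▷ ▷ start = start
turn-start ◁ ◁ start = start
turn-start ▷ ◁ start = start
turn-start ◁ ▷ start = start

lose-now : ∀ {k} (u v : Word k) n {b l c} → ¬ Iso u v c → Wins u v n b l c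
lose-now u v zero    broken = broken
lose-now u v (suc n) broken = inj₁ broken

continue : ∀ {k} (u v : Word k) n s {b b′ l c} → Step l s b b′ → WinsStartingOn u v n b′ s c →
           Wins u v n b l c
continue u v zero    s step won                         = won
continue u v (suc n) s step (inj₁ broken)               = inj₁ broken
continue u v (suc n) U step (inj₂ (b″ , first , move)) = inj₂ (U , b″ , step , move)
continue u v (suc n) V step (inj₂ (b″ , first , move)) = inj₂ (V , b″ , step , move)

swapPebbles : ∀ {lu lv} → Config lu lv → Config lu lv
swapPebbles (conf xu yu xv yv) = conf yu xu yv xv

module _ {k} (u v : Word k) where

  iso-swapPebbles : ∀ c → Iso u v (swapPebbles c) → Iso u v c
  iso-swapPebbles (conf xu yu xv yv) (same-y , same-x , same-order) =
    same-x , same-y , ord-flip-≡ (toℕ yu) (toℕ xu) (toℕ yv) (toℕ xv) same-order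

  mutual
    wins-swapPebbles : ∀ n {b l c} → Wins u v n b l c → Wins u v n b l (swapPebbles c)
    wins-swapPebbles zero    {c = c} won           = won ∘ iso-swapPebbles c
    wins-swapPebbles (suc n) {c = c} (inj₁ broken) = inj₁ (broken ∘ iso-swapPebbles c)
    wins-swapPebbles (suc n) (inj₂ (s , move))     = inj₂ (s , moveWins-swapPebbles n s move)

    moveWins-swapPebbles : ∀ n {b l} s {c} → MoveWins u v n b l s c → MoveWins u v n b l s (swapPebbles c)
    moveWins-swapPebbles n U (b′ , step , X , i , answers) = b′ , step , Y , i , wins-swapPebbles n ∘ answers
    moveWins-swapPebbles n U (b′ , step , Y , i , answers) = b′ , step , X , i , wins-swapPebbles n ∘ answers
    moveWins-swapPebbles n V (b′ , step , X , j , answers) = b′ , step , Y , j , wins-swapPebbles n ∘ answers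
    moveWins-swapPebbles n V (b′ , step , Y , j , answers) = b′ , step , X , j , wins-swapPebbles n ∘ answers

swapWords : ∀ {lu lv} → Config lu lv → Config lv lu
swapWords (conf xu yu xv yv) = conf xv yv xu yu

otherSide : Side → Side
otherSide U = V
otherSide V = U

otherSide-injective : ∀ {s t} → otherSide s ≡ otherSide t → s ≡ t
otherSide-injective {U} {U} _ = refl
otherSide-injective {V} {V} _ = refl

step-swapWords : ∀ {l s b b′} → Step l s b b′ → Step (Maybe.map otherSide l) (otherSide s) b b′
step-swapWords first         = first
step-swapWords stay          = stay
step-swapWords (change s≢t) = change (s≢t ∘ otherSide-injective)

module _ {k} (u v : Word k) where

  iso-swapWords : ∀ c → Iso v u (swapWords c) → Iso u v c
  iso-swapWords c (same-x , same-y , same-order) = sym same-x , sym same-y , sym same-order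

  mutual
    wins-swapWords : ∀ n {b l c} → Wins u v n b l c → Wins v u n b (Maybe.map otherSide l) (swapWords c)
    wins-swapWords zero    {c = c} won           = won ∘ iso-swapWords c
    wins-swapWords (suc n) {c = c} (inj₁ broken) = inj₁ (broken ∘ iso-swapWords c)
    wins-swapWords (suc n) (inj₂ (s , move))     = inj₂ (otherSide s , moveWins-swapWords n s move)

    moveWins-swapWords : ∀ n {b l} s {c} → MoveWins u v n b l s c →
                         MoveWins v u n b (Maybe.map otherSide l) (otherSide s) (swapWords c)
    moveWins-swapWords n U (b′ , step , X , i , answers) =
      b′ , step-swapWords step , X , i , wins-swapWords n ∘ answers
    moveWins-swapWords n U (b′ , step , Y , i , answers) =
      b′ , step-swapWords step , Y , i , wins-swapWords n ∘ answers
    moveWins-swapWords n V (b′ , step , X , j , answers) =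
      b′ , step-swapWords step , X , j , wins-swapWords n ∘ answers
    moveWins-swapWords n V (b′ , step , Y , j , answers) =
      b′ , step-swapWords step , Y , j , wins-swapWords n ∘ answers

  startingOn-swapWords : ∀ n {b s c} → WinsStartingOn u v n b s c →
                         WinsStartingOn v u n b (otherSide s) (swapWords c)
  startingOn-swapWords zero    {c = c} won           = won ∘ iso-swapWords c
  startingOn-swapWords (suc n) {c = c} (inj₁ broken) = inj₁ (broken ∘ iso-swapWords c)
  startingOn-swapWords (suc n) {s = s} (inj₂ move)   = inj₂ (moveWins-swapWords n s move)

-- Samson has put the y-pebble on the a-position pu = pos1 i₀ of u.  If Delilah answers
-- with a position j which is not an a-position, or one d-after pv, the pebbles are no
-- longer isomorphic: j would have to sit relative to x^v as pu sits relative to x^u.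
answer-loses : ∀ d {k} (u v : Word k) {a} pv (c : Config (length u) (length v)) i₀ j →
  lookup u i₀ ≡ a → ord (pos1 i₀) (pos1 (xu c)) ≢ ord pv (pos1 (xv c)) →
  Start U d (pos1 i₀) pv (pos1 (xu c)) (pos1 (xv c)) →
  (lookup v j ≡ a → pv ≤[ d ] pos1 j) → ¬ Iso u v (place Y i₀ j c)
answer-loses d u v pv c i₀ j i₀-letter differ (pu≤x , y≤pv) beyond-pv (_ , same-letter , same-order) =
  let pv≤j       = beyond-pv (trans (sym same-letter) i₀-letter)
      x≡pu , y≡j = ord-squeeze[] d pu≤x (≤[]-trans d y≤pv pv≤j) same-order
      pv≡y       = ≤[]-antisym d (subst (pv ≤[ d ]_) (sym y≡j) pv≤j) y≤pv
  in differ (trans (ord-≡ (sym x≡pu)) (sym (ord-≡ pv≡y)))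

-- The statement proved by induction on n: Samson wins from pebbles separated by a ranker
-- r · (d , a) with n + 1 boundary positions and b + 1 blocks, with b word changes and
-- his first move on the word s allowed by `Start`.
SamsonWins : ℕ → Side → Set
SamsonWins n s = ∀ {k} (u v : Word k) (r : Ranker k) d a {b pu pv} →
  length r ≡ n → blocks (dirs r ∷ʳ d) ≡ suc b →
  eval u (r ∷ʳ (d , a)) ≡ just pu → eval v (r ∷ʳ (d , a)) ≡ just pv →
  (c : Config (length u) (length v)) → ord pu (pos1 (xu c)) ≢ ord pv (pos1 (xv c)) →
  Start s d pu pv (pos1 (xu c)) (pos1 (xv c)) → WinsStartingOn u v (suc n) b s c

mutual
  -- starting on v is starting on u in the game with the words exchanged
  samson : ∀ n s → SamsonWins n s
  samson n U = samsonU n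
  samson n V u v r d a len blocks-r eu ev c differ (x≤pu , pv≤y) =
    startingOn-swapWords v u (suc n) {s = U}
      (samsonU n v u r d a len blocks-r ev eu (swapWords c) (differ ∘ sym) (pv≤y , x≤pu))

  -- Samson puts the y-pebble on r(u) = pu; every answer loses at once (one-position
  -- ranker), or lies within the prefix window and the game goes on by `continue-prefix`.
  samsonU : ∀ n → SamsonWins n U
  samsonU zero _ _ (_ ∷ _) _ _ ()
  samsonU zero u v [] d a {b} {pv = pv} _ _ eu ev c differ start
    with (i₀ , refl , i₀-letter) , _ ← bposAbs-spec d a u eu
       | _ , beyond-pv ← bposAbs-spec d a v ev
    = inj₂ (b , first , Y , i₀ , λ j → answer-loses d u v pv c i₀ j i₀-letter differ start (beyond-pv j))
  samsonU (suc n) u v r d a {b} {pv = pv} len blocks-r eu ev c differ start with initLast r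
  ... | [] with () ← len
  ... | r′ ∷ʳ′ (d′ , a′)
    with qu , eu′ , next-u ← eval-∷ʳ u r′ (d′ , a′) (d , a) eu
       | qv , ev′ , next-v ← eval-∷ʳ v r′ (d′ , a′) (d , a) ev
    with (i₀ , refl , i₀-letter) , qu<pu , _ ← bposRel-spec d a u next-u
       | _ , _ , next-in-v ← bposRel-spec d a v next-v
    = inj₂ (b , first , Y , i₀ , λ j → Sum.[ within-prefix j , beyond-pv j ] (≤[]-<[]-connex d (pos1 j) qv))
    where
      within-prefix : ∀ j → pos1 j ≤[ d ] qv → Wins u v (suc n) b (just U) (place Y i₀ j c)
      within-prefix j j≤qv =
        continue-prefix n u v r′ d′ a′ d (length-init r′ (d′ , a′) len) blocks-r eu′ ev′
          (conf i₀ (xu c) j (xv c)) (ord-separated d qu<pu j≤qv) (<[]⇒≤[] d qu<pu , j≤qv)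
      beyond-pv : ∀ j → qv <[ d ] pos1 j → Wins u v (suc n) b (just U) (place Y i₀ j c)
      beyond-pv j qv<j = lose-now u v (suc n)
        (answer-loses d u v pv c i₀ j i₀-letter differ start (λ letter → next-in-v j letter qv<j))

  -- After Samson's move and an answer within the window of the prefix r · (d′ , a′), the
  -- new pebbles (now the x-pebbles, after renaming) are separated by that prefix ranker.
  continue-prefix : ∀ n {k} (u v : Word k) (r : Ranker k) d′ a′ d {b qu qv} →
    length r ≡ n → blocks (dirs (r ∷ʳ (d′ , a′)) ∷ʳ d) ≡ suc b →
    eval u (r ∷ʳ (d′ , a′)) ≡ just qu → eval v (r ∷ʳ (d′ , a′)) ≡ just qv →
    (c : Config (length u) (length v)) → ord qu (pos1 (xu c)) ≢ ord qv (pos1 (xv c)) →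
    Start U d qu qv (pos1 (xu c)) (pos1 (xv c)) → Wins u v (suc n) b (just U) (swapPebbles c)
  continue-prefix n u v r d′ a′ d {b} len blocks-r eu ev c differ start
    with b′ , step , blocks-prefix ← blocks-turn (dirs r) d′ d
           (subst (λ ds → blocks (ds ∷ʳ d) ≡ suc b) (dirs-∷ʳ r (d′ , a′)) blocks-r)
    = wins-swapPebbles u v (suc n) (continue u v (suc n) (turn d′ d) step
        (samson n (turn d′ d) u v r d′ a′ len blocks-prefix eu ev c differ (turn-start d′ d start)))

-- The theorem: split r = r′ · (d , a); the (m,n)-ranker has m blocks, i.e. m - 1 word
-- changes, and the separated pebbles let Samson start on u or on v as `Start` says.
lemma4p2 : ∀ {k} (m n : ℕ) → 1 ≤ m → m ≤ n →
    (u v : Word k) (r : Ranker k) → IsRanker m n r →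
    (pu pv : ℕ) → eval u r ≡ just pu → eval v r ≡ just pv →
    (c : Config (length u) (length v)) →
    ord pu (pos1 (xu c)) ≢ ord pv (pos1 (xv c)) →
    Wins u v n (m ∸ 1) nothing c
    × ((EndsWith ▷ r × pu ≤ pos1 (xu c) × pos1 (xv c) ≤ pv)
       ⊎ (EndsWith ◁ r × pos1 (xu c) ≤ pu × pv ≤ pos1 (xv c))
       → WinsStartingOn u v n (m ∸ 1) U c)
    × ((EndsWith ▷ r × pos1 (xu c) ≤ pu × pv ≤ pos1 (xv c))
       ⊎ (EndsWith ◁ r × pu ≤ pos1 (xu c) × pos1 (xv c) ≤ pv)
       → WinsStartingOn u v n (m ∸ 1) V c)
lemma4p2 zero    _       ()
lemma4p2 (suc m) zero    _ ()
lemma4p2 (suc m) (suc n) _ _ u v r (len , blocks-r) pu pv eu ev c differ with initLast r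
... | [] with () ← len
... | r′ ∷ʳ′ (d , a) =
      Sum.[ continue u v (suc n) U first ∘ start U , continue u v (suc n) V first ∘ start V ]
        (start-cases d differ)
    , Sum.[ uncurry (by-last-direction U) , uncurry (by-last-direction U) ]
    , Sum.[ uncurry (by-last-direction V) , uncurry (by-last-direction V) ]
  where
    start : ∀ s → Start s d pu pv (pos1 (xu c)) (pos1 (xv c)) → WinsStartingOn u v (suc n) m s c
    start s = samson n s u v r′ d a (length-init r′ (d , a) len)
                (trans (cong blocks (sym (dirs-∷ʳ r′ (d , a)))) blocks-r) eu ev c differ

    by-last-direction : ∀ {e} s → EndsWith e (r′ ∷ʳ (d , a)) →
                        Start s e pu pv (pos1 (xu c)) (pos1 (xv c)) → WinsStartingOn u v (suc n) m s c
    by-last-direction s ends with refl ← endsWith-∷ʳ r′ (d , a) ends = start s
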